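{- 1. If $L$ is a totally ordered BL-algebra, then its Chang group $(G_L,\preceq)$ is totally ordered (an $o$-group). 2. If $L$ is a BL-algebra of cancellative type whose Chang group $(G_L,\preceq)$ is totally ordered, then $L$ is totally ordered.
   Context: A BL-algebra is an algebra $(L,\wedge,\vee,\otimes,\to,0,1)$ such that $(L,\wedge,\vee,0,1)$ is a bounded lattice, $(L,\otimes,1)$ is a commutative monoid, $x\otimes y\le z$ iff $x\le y\to z$, $x\wedge y=x\otimes(x\to y)$, and $(x\to y)\vee(y\to x)=1$; a BL-chain is a totally ordered BL-algebra. Put $\bar x=x\to0$, $x\oslash y=\bar x\to y$, $x+y=(x\oslash y)\wedge(y\oslash x)$. A BL-chain $C$ is of cancellative type if for all $x,y,z\in C$, $x+y=x+z$ and $x\otimes y=x\otimes z$ imply $y=z$; a BL-algebra is of cancellative type if it is a subdirect product of BL-chains of cancellative type. A good sequence is a sequence $(a_1,a_2,\ldots)$ in $L$ with $a_i+a_{i+1}=a_i$ for all $i$ and $a_r=0$ for large $r$. Sum: $(\mathbf{a}+\mathbf{b})_i=a_i+(a_{i-1}\otimes b_1)+\cdots+(a_1\otimes b_{i-1})+b_i$. $M_L$ is the commutative monoid of good sequences, ordered componentwise. The Chang group $G_L=(M_L\times M_L)/\sim$, $(\mathbf{a},\mathbf{b})\sim(\mathbf{c},\mathbf{d})$ iff $\mathbf{a}+\mathbf{d}+\mathbf{k}=\mathbf{b}+\mathbf{c}+\mathbf{k}$ for some $\mathbf{k}\in M_L$; classes $[\mathbf{a},\mathbf{b}]$, addition componentwise,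 order $[\mathbf{a},\mathbf{b}]\preceq[\mathbf{c},\mathbf{d}]$ iff $\mathbf{a}+\mathbf{d}+\mathbf{k}\le\mathbf{b}+\mathbf{c}+\mathbf{k}$ for some $\mathbf{k}\in M_L$. -}

module Defs where

open import Data.Nat using (ℕ; zero; suc; _∸_) renaming (_≤_ to _≤ℕ_)
open import Data.Product using (Σ; ∃; _×_; _,_; proj₁)
open import Data.Sum using (_⊎_)
open import Relation.Binary.PropositionalEquality using (_≡_)
open import Function.Bundles using (_⇔_)

record BLAlgebra : Set₁ where
  field
    Carrier : Set
    _∧_ _∨_ _⊗_ _⇒_ : Carrier → Carrier → Carrier
    𝟘 𝟙 : Carrier
  infixr 7 _∧_
  infixr 6 _∨_
  infixr 8 _⊗_
  infixr 5 _⇒_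
  field
    ∧-assoc : ∀ x y z → (x ∧ y) ∧ z ≡ x ∧ (y ∧ z)
    ∨-assoc : ∀ x y z → (x ∨ y) ∨ z ≡ x ∨ (y ∨ z)
    ∧-comm  : ∀ x y → x ∧ y ≡ y ∧ x
    ∨-comm  : ∀ x y → x ∨ y ≡ y ∨ x
    ∧-absorbs-∨ : ∀ x y → x ∧ (x ∨ y) ≡ x
    ∨-absorbs-∧ : ∀ x y → x ∨ (x ∧ y) ≡ x
    𝟘-bottom : ∀ x → 𝟘 ∧ x ≡ 𝟘
    𝟙-top    : ∀ x → x ∧ 𝟙 ≡ x
    ⊗-assoc : ∀ x y z → (x ⊗ y) ⊗ z ≡ x ⊗ (y ⊗ z)
    ⊗-comm  : ∀ x y → x ⊗ y ≡ y ⊗ x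
    ⊗-identityʳ : ∀ x → x ⊗ 𝟙 ≡ x
    -- residuation: x ⊗ y ≤ z iff x ≤ y ⇒ z   (lattice order: a ≤ b iff a ∧ b = a)
    residuation : ∀ x y z → (((x ⊗ y) ∧ z ≡ x ⊗ y) ⇔ (x ∧ (y ⇒ z) ≡ x))
    divisibility : ∀ x y → x ∧ y ≡ x ⊗ (x ⇒ y)
    prelinearity : ∀ x y → (x ⇒ y) ∨ (y ⇒ x) ≡ 𝟙

module BLOps (L : BLAlgebra) where
  open BLAlgebra L

  _≤_ : Carrier → Carrier → Set
  x ≤ y = x ∧ y ≡ x

  neg : Carrier → Carrier
  neg x = x ⇒ 𝟘

  _⊘_ : Carrier → Carrier → Carrier
  x ⊘ y = neg x ⇒ y

  _⊕_ : Carrier → Carrier → Carrier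
  x ⊕ y = (x ⊘ y) ∧ (y ⊘ x)

  -- Sequences are indexed from 0: s n stands for a_{n+1}.
  Seq : Set
  Seq = ℕ → Carrier

  IsGood : Seq → Set
  IsGood a = (∀ n → a n ⊕ a (suc n) ≡ a n)
           × (∃ λ r → ∀ n → r ≤ℕ n → a n ≡ 𝟘)

  GoodSeq : Set
  GoodSeq = Σ Seq IsGood

  -- 1-indexed extension with a_0 = 1
  ext : Seq → ℕ → Carrier
  ext s zero = 𝟙
  ext s (suc n) = s n

  psum : Seq → Seq → ℕ → ℕ → Carrier
  psum a b i zero = ext a i ⊗ ext b zero
  psum a b i (suc k) = psum a b i k ⊕ (ext a (i ∸ suc k) ⊗ ext b (suc k))

  -- (a + b)_i = a_i + (a_{i-1} ⊗ b_1) + ... + (a_1 ⊗ b_{i-1}) + b_i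
  _+ₛ_ : Seq → Seq → Seq
  (a +ₛ b) n = psum a b (suc n) (suc n)

  _≤ₛ_ : Seq → Seq → Set
  a ≤ₛ b = ∀ n → a n ≤ b n

  -- elements of the Chang group are represented by pairs of good sequences
  ChangElem : Set
  ChangElem = GoodSeq × GoodSeq

  _⪯_ : ChangElem → ChangElem → Set
  (a , b) ⪯ (c , d) =
    ∃ λ (k : GoodSeq) →
      ((proj₁ a +ₛ proj₁ d) +ₛ proj₁ k) ≤ₛ ((proj₁ b +ₛ proj₁ c) +ₛ proj₁ k)

TotallyOrdered : BLAlgebra → Set
TotallyOrdered L = ∀ x y → x ≤ y ⊎ y ≤ x
  where open BLAlgebra L ; open BLOps L

ChangTotallyOrdered : BLAlgebra → Set
ChangTotallyOrdered L = ∀ (g h : ChangElem) → g ⪯ h ⊎ h ⪯ g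
  where open BLOps L

CancellativeChain : BLAlgebra → Set
CancellativeChain L =
  TotallyOrdered L ×
  (∀ x y z → x ⊕ y ≡ x ⊕ z → x ⊗ y ≡ x ⊗ z → y ≡ z)
  where open BLAlgebra L ; open BLOps L

record BLHom (L M : BLAlgebra) : Set where
  private
    module L = BLAlgebra L
    module M = BLAlgebra M
  field
    f : L.Carrier → M.Carrier
    pres-∧ : ∀ x y → f (x L.∧ y) ≡ f x M.∧ f y
    pres-∨ : ∀ x y → f (x L.∨ y) ≡ f x M.∨ f y
    pres-⊗ : ∀ x y → f (x L.⊗ y) ≡ f x M.⊗ f y
    pres-⇒ : ∀ x y → f (x L.⇒ y) ≡ f x M.⇒ f y
    pres-𝟘 : f L.𝟘 ≡ M.𝟘
    pres-𝟙 : f L.𝟙 ≡ M.𝟙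

-- L is a subdirect product of the family C : I → BLAlgebra:
-- an embedding into ∏ C i whose coordinate projections are all surjective.
record SubdirectProduct (L : BLAlgebra) {I : Set} (C : I → BLAlgebra) : Set where
  field
    π : ∀ i → BLHom L (C i)
    jointly-injective : ∀ x y → (∀ i → BLHom.f (π i) x ≡ BLHom.f (π i) y) → x ≡ y
    surjective : ∀ i (y : BLAlgebra.Carrier (C i)) → ∃ λ x → BLHom.f (π i) x ≡ y

CancellativeType : BLAlgebra → Set₁
CancellativeType L =
  Σ Set λ I → Σ (I → BLAlgebra) λ C →
    (∀ i → CancellativeChain (C i)) × SubdirectProduct L C

module Submission where

-- Part 1.  In a BL-chain every good sequence is a staircase (1,…,1,x,0,0,…).  In any
-- BL-algebra the sum of two staircases with steps m and p is computed explicitly: ones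
-- before position m+p, then s_m ⊕ t_p, then s_m ⊗ t_p, then zeros.  Hence, in a chain,
-- staircases are closed under + and any two of them are componentwise comparable; and +
-- is commutative on staircases.  For [a,b] and [c,d] the sequences (a+d)+a and (b+c)+a
-- are therefore comparable, which is the required comparison with k = a.
--
-- Part 2.  Compare [x̂,0̂] with [ŷ,0̂], where x̂ = (x,0,0,…) and x̂ + 0̂ = x̂.  A witness k
-- gives x̂+k ≤ ŷ+k componentwise.  Apply a projection π onto a cancellative chain: there
-- π(k) is a staircase with step w at position p, and positions p, p+1 of the sums read
-- X⊕w ≤ Y⊕w and X⊗w ≤ Y⊗w.  If Y ≤ X both are equalities and cancellation gives X = Y,
-- so X ≤ Y in every case.  The projections being jointly injective, x ≤ y in L.

open import Defs
open import Data.Product using (_×_; _,_; proj₁; proj₂)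
open import Data.Sum using (_⊎_; inj₁; inj₂)
open import Data.Nat using (ℕ; zero; suc; _+_; _∸_; z≤n; s≤s) renaming (_≤_ to _≤ℕ_; _<_ to _<ℕ_)
import Data.Nat.Properties as ℕ
open import Relation.Binary.PropositionalEquality
open import Relation.Binary.Definitions using (tri<; tri≈; tri>)
open import Function.Bundles using (Equivalence)

module BLProperties (L : BLAlgebra) where
  open BLAlgebra L
  open BLOps L

  residual-intro : ∀ x y z → (x ⊗ y) ≤ z → x ≤ (y ⇒ z)
  residual-intro x y z = Equivalence.to (residuation x y z)

  residual-elim : ∀ x y z → x ≤ (y ⇒ z) → (x ⊗ y) ≤ z
  residual-elim x y z = Equivalence.from (residuation x y z)

  ∧-idem : ∀ x → x ∧ x ≡ x
  ∧-idem x = trans (cong (x ∧_) (sym (∨-absorbs-∧ x x))) (∧-absorbs-∨ x (x ∧ x))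

  ≤-refl : ∀ x → x ≤ x
  ≤-refl = ∧-idem

  ≤-antisym : ∀ {x y} → x ≤ y → y ≤ x → x ≡ y
  ≤-antisym {x} {y} x≤y y≤x = trans (sym x≤y) (trans (∧-comm x y) y≤x)

  ≤-trans : ∀ {x y z} → x ≤ y → y ≤ z → x ≤ z
  ≤-trans {x} {y} {z} x≤y y≤z =
    trans (cong (_∧ z) (sym x≤y)) (trans (∧-assoc x y z) (trans (cong (x ∧_) y≤z) x≤y))

  top-unique : ∀ {w} → 𝟙 ≤ w → w ≡ 𝟙
  top-unique {w} 𝟙≤w = ≤-antisym (𝟙-top w) 𝟙≤w

  bottom-unique : ∀ {w} → w ≤ 𝟘 → w ≡ 𝟘
  bottom-unique {w} w≤𝟘 = ≤-antisym w≤𝟘 (𝟘-bottom w)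

  ∧-lowerˡ : ∀ a b → (a ∧ b) ≤ a
  ∧-lowerˡ a b = trans (∧-assoc a b a) (trans (cong (a ∧_) (∧-comm b a))
    (trans (sym (∧-assoc a a b)) (cong (_∧ b) (∧-idem a))))

  ∧-lowerʳ : ∀ a b → (a ∧ b) ≤ b
  ∧-lowerʳ a b = trans (∧-assoc a b b) (cong (a ∧_) (∧-idem b))

  ∧-greatest : ∀ {u a b} → u ≤ a → u ≤ b → u ≤ (a ∧ b)
  ∧-greatest {u} {a} {b} u≤a u≤b = trans (sym (∧-assoc u a b)) (trans (cong (_∧ b) u≤a) u≤b)

  ∧-mono : ∀ {a a′ b b′} → a ≤ a′ → b ≤ b′ → (a ∧ b) ≤ (a′ ∧ b′)
  ∧-mono {a} {a′} {b} {b′} a≤a′ b≤b′ =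
    ∧-greatest (≤-trans (∧-lowerˡ a b) a≤a′) (≤-trans (∧-lowerʳ a b) b≤b′)

  ⊗-identityˡ : ∀ x → 𝟙 ⊗ x ≡ x
  ⊗-identityˡ x = trans (⊗-comm 𝟙 x) (⊗-identityʳ x)

  ⇒-of-≤ : ∀ {x y} → x ≤ y → (x ⇒ y) ≡ 𝟙
  ⇒-of-≤ {x} {y} x≤y = top-unique (residual-intro 𝟙 x y (subst (_≤ y) (sym (⊗-identityˡ x)) x≤y))

  ⇒-identityˡ : ∀ y → (𝟙 ⇒ y) ≡ y
  ⇒-identityˡ y = trans (sym (⊗-identityˡ (𝟙 ⇒ y)))
    (trans (sym (divisibility 𝟙 y)) (trans (∧-comm 𝟙 y) (𝟙-top y)))

  ⊗-zeroʳ : ∀ x → x ⊗ 𝟘 ≡ 𝟘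
  ⊗-zeroʳ x = bottom-unique (residual-elim x 𝟘 𝟘 (subst (x ≤_) (sym (⇒-of-≤ (≤-refl 𝟘))) (𝟙-top x)))

  ⊗-zeroˡ : ∀ x → 𝟘 ⊗ x ≡ 𝟘
  ⊗-zeroˡ x = trans (⊗-comm 𝟘 x) (⊗-zeroʳ x)

  ⊗-neg : ∀ x → x ⊗ neg x ≡ 𝟘
  ⊗-neg x = trans (⊗-comm x (neg x)) (bottom-unique (residual-elim (neg x) x 𝟘 (≤-refl (neg x))))

  ≤-double-neg : ∀ x → x ≤ neg (neg x)
  ≤-double-neg x = residual-intro x (neg x) 𝟘 (subst (_≤ 𝟘) (sym (⊗-neg x)) (≤-refl 𝟘))

  neg-𝟘 : neg 𝟘 ≡ 𝟙
  neg-𝟘 = ⇒-of-≤ (≤-refl 𝟘)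

  neg-𝟙 : neg 𝟙 ≡ 𝟘
  neg-𝟙 = ⇒-identityˡ 𝟘

  ⊗-monoˡ : ∀ {x y} w → y ≤ x → (y ⊗ w) ≤ (x ⊗ w)
  ⊗-monoˡ {x} {y} w y≤x = residual-elim y w (x ⊗ w) (≤-trans y≤x (residual-intro x w (x ⊗ w) (≤-refl _)))

  ⊗-monoʳ : ∀ {x y} w → y ≤ x → (w ⊗ y) ≤ (w ⊗ x)
  ⊗-monoʳ {x} {y} w y≤x = subst₂ _≤_ (⊗-comm y w) (⊗-comm x w) (⊗-monoˡ w y≤x)

  ⇒-monoʳ : ∀ {a b} c → a ≤ b → (c ⇒ a) ≤ (c ⇒ b)
  ⇒-monoʳ {a} {b} c a≤b = residual-intro (c ⇒ a) c b (≤-trans (residual-elim (c ⇒ a) c a (≤-refl _)) a≤b)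

  ⇒-antiˡ : ∀ {a b} c → a ≤ b → (b ⇒ c) ≤ (a ⇒ c)
  ⇒-antiˡ {a} {b} c a≤b =
    residual-intro (b ⇒ c) a c (≤-trans (⊗-monoʳ (b ⇒ c) a≤b) (residual-elim (b ⇒ c) b c (≤-refl _)))

  ⊕-identityʳ : ∀ x → x ⊕ 𝟘 ≡ x
  ⊕-identityʳ x = trans (cong (λ u → neg (neg x) ∧ (u ⇒ x)) neg-𝟘)
    (trans (cong (neg (neg x) ∧_) (⇒-identityˡ x)) (trans (∧-comm _ x) (≤-double-neg x)))

  ⊕-identityˡ : ∀ x → 𝟘 ⊕ x ≡ x
  ⊕-identityˡ x = trans (cong (λ u → (u ⇒ x) ∧ neg (neg x)) neg-𝟘)
    (trans (cong (_∧ neg (neg x)) (⇒-identityˡ x)) (≤-double-neg x))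

  ⊕-absorbʳ : ∀ x → x ⊕ 𝟙 ≡ 𝟙
  ⊕-absorbʳ x = trans (cong₂ _∧_ (⇒-of-≤ (𝟙-top (neg x)))
                                 (trans (cong (_⇒ x) neg-𝟙) (⇒-of-≤ (𝟘-bottom x))))
                      (𝟙-top 𝟙)

  ⊕-absorbˡ : ∀ x → 𝟙 ⊕ x ≡ 𝟙
  ⊕-absorbˡ x = trans (cong₂ _∧_ (trans (cong (_⇒ x) neg-𝟙) (⇒-of-≤ (𝟘-bottom x)))
                                 (⇒-of-≤ (𝟙-top (neg x))))
                      (𝟙-top 𝟙)

  ⊕-comm : ∀ x y → x ⊕ y ≡ y ⊕ x
  ⊕-comm x y = ∧-comm _ _

  ⊕-monoˡ : ∀ {x y} w → y ≤ x → (y ⊕ w) ≤ (x ⊕ w)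
  ⊕-monoˡ {x} {y} w y≤x = ∧-mono (⇒-antiˡ w (⇒-antiˡ 𝟘 y≤x)) (⇒-monoʳ (neg w) y≤x)

module Sequences (L : BLAlgebra) where
  open BLAlgebra L
  open BLOps L
  open BLProperties L

  ext-cong : ∀ {s s′} → (∀ n → s n ≡ s′ n) → ∀ q → ext s q ≡ ext s′ q
  ext-cong s≗s′ zero = refl
  ext-cong s≗s′ (suc q) = s≗s′ q

  psum-cong : ∀ {s s′ t t′} → (∀ n → s n ≡ s′ n) → (∀ n → t n ≡ t′ n)
            → ∀ i k → psum s t i k ≡ psum s′ t′ i k
  psum-cong s≗s′ t≗t′ i zero = cong (_⊗ 𝟙) (ext-cong s≗s′ i)
  psum-cong s≗s′ t≗t′ i (suc k) =
    cong₂ _⊕_ (psum-cong s≗s′ t≗t′ i k)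
              (cong₂ _⊗_ (ext-cong s≗s′ (i ∸ suc k)) (ext-cong t≗t′ (suc k)))

  +ₛ-congˡ : ∀ {s s′} t → (∀ n → s n ≡ s′ n) → ∀ n → (s +ₛ t) n ≡ (s′ +ₛ t) n
  +ₛ-congˡ t s≗s′ n = psum-cong s≗s′ (λ _ → refl) (suc n) (suc n)

  ≤ₛ-resp : ∀ {a a′ b b′} → (∀ n → a n ≡ a′ n) → (∀ n → b n ≡ b′ n) → a ≤ₛ b → a′ ≤ₛ b′
  ≤ₛ-resp a≗a′ b≗b′ a≤b n = subst₂ _≤_ (a≗a′ n) (b≗b′ n) (a≤b n)

  term : Seq → Seq → ℕ → ℕ → Carrier
  term s t i j = ext s (i ∸ j) ⊗ ext t j

  psum-𝟙 : ∀ s t i k j → j ≤ℕ k → term s t i j ≡ 𝟙 → psum s t i k ≡ 𝟙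
  psum-𝟙 s t i zero .zero z≤n term≡𝟙 = term≡𝟙
  psum-𝟙 s t i (suc k) j j≤k term≡𝟙 with ℕ.m≤n⇒m<n∨m≡n j≤k
  ... | inj₁ (s≤s j≤k′) =
    trans (cong (_⊕ term s t i (suc k)) (psum-𝟙 s t i k j j≤k′ term≡𝟙)) (⊕-absorbˡ _)
  ... | inj₂ refl = trans (cong (psum s t i k ⊕_) term≡𝟙) (⊕-absorbʳ _)

  psum-𝟘 : ∀ s t i k → (∀ j → j ≤ℕ k → term s t i j ≡ 𝟘) → psum s t i k ≡ 𝟘
  psum-𝟘 s t i zero zeros = zeros 0 z≤n
  psum-𝟘 s t i (suc k) zeros =
    trans (cong₂ _⊕_ (psum-𝟘 s t i k (λ j j≤k → zeros j (ℕ.m≤n⇒m≤1+n j≤k))) (zeros (suc k) ℕ.≤-refl))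
          (⊕-identityʳ 𝟘)

  psum-truncate : ∀ s t i a k → a ≤ℕ k → (∀ j → a <ℕ j → j ≤ℕ k → term s t i j ≡ 𝟘)
                → psum s t i k ≡ psum s t i a
  psum-truncate s t i .zero zero z≤n zeros = refl
  psum-truncate s t i a (suc k) a≤k zeros with ℕ.m≤n⇒m<n∨m≡n a≤k
  ... | inj₂ refl = refl
  ... | inj₁ (s≤s a≤k′) = trans (cong (psum s t i k ⊕_) (zeros (suc k) (s≤s a≤k′) ℕ.≤-refl))
      (trans (⊕-identityʳ _)
             (psum-truncate s t i a k a≤k′ (λ j a<j j≤k → zeros j a<j (ℕ.m≤n⇒m≤1+n j≤k))))

  psum-last : ∀ s t i k → (∀ j → j <ℕ k → term s t i j ≡ 𝟘) → psum s t i k ≡ term s t i k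
  psum-last s t i zero zeros = refl
  psum-last s t i (suc k) zeros =
    trans (cong (_⊕ term s t i (suc k)) (psum-𝟘 s t i k (λ j j≤k → zeros j (s≤s j≤k)))) (⊕-identityˡ _)

  record Staircase (s : Seq) : Set where
    field
      step  : ℕ
      ones  : ∀ j → j <ℕ step → s j ≡ 𝟙
      zeros : ∀ j → step <ℕ j → s j ≡ 𝟘

    ext-ones : ∀ q → q ≤ℕ step → ext s q ≡ 𝟙
    ext-ones zero q≤step = refl
    ext-ones (suc q) q<step = ones q q<step

    ext-zeros : ∀ q → suc step <ℕ q → ext s q ≡ 𝟘
    ext-zeros (suc q) (s≤s step<q) = zeros q step<q

  module StaircaseSum {s t : Seq} (S : Staircase s) (T : Staircase t) where
    open Staircase S using () renaming (step to m; ext-ones to s-ones; ext-zeros to s-zeros)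
    open Staircase T using () renaming (step to p; ext-ones to t-ones; ext-zeros to t-zeros)

    term-one : ∀ i j → i ∸ j ≤ℕ m → j ≤ℕ p → term s t i j ≡ 𝟙
    term-one i j i∸j≤m j≤p = trans (cong₂ _⊗_ (s-ones (i ∸ j) i∸j≤m) (t-ones j j≤p)) (⊗-identityʳ 𝟙)

    term-zero-right : ∀ i j → suc p <ℕ j → term s t i j ≡ 𝟘
    term-zero-right i j p<j = trans (cong (ext s (i ∸ j) ⊗_) (t-zeros j p<j)) (⊗-zeroʳ _)

    term-zero-left : ∀ i j → suc m <ℕ i ∸ j → term s t i j ≡ 𝟘
    term-zero-left i j m<i∸j = trans (cong (_⊗ ext t j) (s-zeros (i ∸ j) m<i∸j)) (⊗-zeroˡ _)

    left-far : ∀ i j → suc (suc m) + j ≤ℕ i → suc m <ℕ i ∸ j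
    left-far i j = ℕ.m+n≤o⇒m≤o∸n (suc (suc m))

    -- (s+t)_n = 1 for n < m+p: some term pairs two ones
    sum-below : ∀ n → n <ℕ m + p → (s +ₛ t) n ≡ 𝟙
    sum-below n n<m+p with ℕ.≤-<-connex (suc n) p
    ... | inj₁ n<p = psum-𝟙 s t (suc n) (suc n) (suc n) ℕ.≤-refl
        (term-one (suc n) (suc n) (subst (_≤ℕ m) (sym (ℕ.n∸n≡0 n)) z≤n) n<p)
    ... | inj₂ p≤n = psum-𝟙 s t (suc n) (suc n) p (ℕ.<⇒≤ p≤n)
        (term-one (suc n) p (subst (suc n ∸ p ≤ℕ_) (ℕ.m+n∸n≡m m p) (ℕ.∸-monoˡ-≤ p n<m+p)) ℕ.≤-refl)

    -- at position m+p only the terms s_m ⊗ 1 and 1 ⊗ t_p survive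
    sum-at : (s +ₛ t) (m + p) ≡ s m ⊕ t p
    sum-at = begin
      psum s t i i
        ≡⟨ psum-truncate s t i (suc p) i (s≤s (ℕ.m≤n+m p m)) (λ j p<j _ → term-zero-right i j p<j) ⟩
      psum s t i p ⊕ term s t i (suc p)
        ≡⟨ cong (_⊕ term s t i (suc p)) (psum-last s t i p left-zero) ⟩
      term s t i p ⊕ term s t i (suc p)
        ≡⟨ cong₂ _⊕_ term-p term-suc-p ⟩
      s m ⊕ t p
        ∎
      where
      open ≡-Reasoning
      i : ℕ
      i = suc (m + p)
      left-zero : ∀ j → j <ℕ p → term s t i j ≡ 𝟘
      left-zero j j<p = term-zero-left i j (left-far i j
        (s≤s (subst (_≤ℕ m + p) (ℕ.+-suc m j) (ℕ.+-monoʳ-≤ m j<p))))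
      term-p : term s t i p ≡ s m
      term-p = trans (cong₂ _⊗_ (cong (ext s) (ℕ.m+n∸n≡m (suc m) p)) (t-ones p ℕ.≤-refl)) (⊗-identityʳ _)
      term-suc-p : term s t i (suc p) ≡ t p
      term-suc-p = trans (cong (_⊗ t p) (trans (cong (ext s) (ℕ.m+n∸n≡m m p)) (s-ones m ℕ.≤-refl)))
        (⊗-identityˡ _)

    -- at position m+p+1 only the term s_m ⊗ t_p survives
    sum-next : (s +ₛ t) (suc (m + p)) ≡ s m ⊗ t p
    sum-next = begin
      psum s t i i
        ≡⟨ psum-truncate s t i (suc p) i (s≤s (ℕ.m≤n⇒m≤1+n (ℕ.m≤n+m p m)))
                         (λ j p<j _ → term-zero-right i j p<j) ⟩
      psum s t i (suc p)
        ≡⟨ psum-last s t i (suc p) left-zero ⟩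
      ext s (i ∸ suc p) ⊗ t p
        ≡⟨ cong (λ q → ext s q ⊗ t p) (ℕ.m+n∸n≡m (suc m) p) ⟩
      s m ⊗ t p
        ∎
      where
      open ≡-Reasoning
      i : ℕ
      i = suc (suc (m + p))
      left-zero : ∀ j → j <ℕ suc p → term s t i j ≡ 𝟘
      left-zero j (s≤s j≤p) = term-zero-left i j (left-far i j (s≤s (s≤s (ℕ.+-monoʳ-≤ m j≤p))))

    sum-above : ∀ n → suc (m + p) <ℕ n → (s +ₛ t) n ≡ 𝟘
    sum-above n m+p<n = psum-𝟘 s t (suc n) (suc n) all-zero
      where
      far : suc (suc m) + suc p ≤ℕ suc n
      far = s≤s (subst (_≤ℕ n) (sym (ℕ.+-suc (suc m) p)) m+p<n)
      all-zero : ∀ j → j ≤ℕ suc n → term s t (suc n) j ≡ 𝟘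
      all-zero j _ with ℕ.≤-<-connex j (suc p)
      ... | inj₁ j≤p = term-zero-left (suc n) j
        (left-far (suc n) j (ℕ.≤-trans (ℕ.+-monoʳ-≤ (suc (suc m)) j≤p) far))
      ... | inj₂ p<j = term-zero-right (suc n) j p<j

  module _ {s t : Seq} (S : Staircase s) (T : Staircase t) where
    private
      module ST = StaircaseSum S T
      module TS = StaircaseSum T S
      open Staircase S using () renaming (step to m)
      open Staircase T using () renaming (step to p)
      open ≡-Reasoning

    +ₛ-comm : ∀ n → (s +ₛ t) n ≡ (t +ₛ s) n
    +ₛ-comm n with ℕ.<-cmp n (m + p)
    ... | tri< n<m+p _ _ =
      trans (ST.sum-below n n<m+p) (sym (TS.sum-below n (subst (n <ℕ_) (ℕ.+-comm m p) n<m+p)))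
    ... | tri≈ _ refl _ = begin
      (s +ₛ t) (m + p)  ≡⟨ ST.sum-at ⟩
      s m ⊕ t p         ≡⟨ ⊕-comm (s m) (t p) ⟩
      t p ⊕ s m         ≡⟨ sym TS.sum-at ⟩
      (t +ₛ s) (p + m)  ≡⟨ cong (t +ₛ s) (ℕ.+-comm p m) ⟩
      (t +ₛ s) (m + p)  ∎
    ... | tri> _ _ m+p<n with ℕ.m≤n⇒m<n∨m≡n m+p<n
    ...   | inj₂ refl = begin
      (s +ₛ t) (suc (m + p))  ≡⟨ ST.sum-next ⟩
      s m ⊗ t p               ≡⟨ ⊗-comm (s m) (t p) ⟩
      t p ⊗ s m               ≡⟨ sym TS.sum-next ⟩
      (t +ₛ s) (suc (p + m))  ≡⟨ cong (λ q → (t +ₛ s) (suc q)) (ℕ.+-comm p m) ⟩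
      (t +ₛ s) (suc (m + p))  ∎
    ...   | inj₁ m+p<′n = trans (ST.sum-above n m+p<′n)
                                (sym (TS.sum-above n (subst (λ q → suc q <ℕ n) (ℕ.+-comm m p) m+p<′n)))

module Chain (L : BLAlgebra) (total : TotallyOrdered L) where
  open BLAlgebra L
  open BLOps L
  open BLProperties L
  open Sequences L

  ∧-selective : ∀ a b → a ∧ b ≡ a ⊎ a ∧ b ≡ b
  ∧-selective a b with total a b
  ... | inj₁ a≤b = inj₁ a≤b
  ... | inj₂ b≤a = inj₂ (trans (∧-comm a b) b≤a)

  absorbed-left : ∀ x y → (neg x ⇒ y) ≡ x → x ≡ 𝟙 ⊎ y ≡ 𝟘
  absorbed-left x y e with total y (neg x)
  ... | inj₂ x̄≤y = inj₁ (trans (sym e) (⇒-of-≤ x̄≤y))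
  ... | inj₁ y≤x̄ = inj₂ (trans (sym y≤x̄) (trans (∧-comm y (neg x)) x̄∧y≡𝟘))
    where
    x̄∧y≡𝟘 : neg x ∧ y ≡ 𝟘
    x̄∧y≡𝟘 = trans (divisibility (neg x) y)
                  (trans (cong (neg x ⊗_) e) (trans (⊗-comm (neg x) x) (⊗-neg x)))

  absorbed-right : ∀ x y → (neg y ⇒ x) ≡ x → x ≡ 𝟙 ⊎ y ≡ 𝟘
  absorbed-right x y e with total (neg y) x
  ... | inj₁ ȳ≤x = inj₁ (trans (sym e) (⇒-of-≤ ȳ≤x))
  ... | inj₂ x≤ȳ = inj₂ y≡𝟘
    where
    open ≡-Reasoning
    -- x = ȳ ⊗ x, since x ≤ ȳ and ȳ ⇒ x = x
    ȳ⊗x≡x : neg y ⊗ x ≡ x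
    ȳ⊗x≡x = trans (cong (neg y ⊗_) (sym e))
                  (trans (sym (divisibility (neg y) x)) (trans (∧-comm _ _) x≤ȳ))
    -- y ≤ ȳ ⇒ x = x, since y ⊗ ȳ = 0
    y≤x : y ≤ x
    y≤x = subst (y ≤_) e (residual-intro y (neg y) x (subst (_≤ x) (sym (⊗-neg y)) (𝟘-bottom x)))
    y-divides : y ≡ x ⊗ (x ⇒ y)
    y-divides = trans (sym y≤x) (trans (∧-comm y x) (divisibility x y))
    y≡𝟘 : y ≡ 𝟘
    y≡𝟘 = begin
      y                         ≡⟨ y-divides ⟩
      x ⊗ (x ⇒ y)               ≡⟨ cong (_⊗ (x ⇒ y)) (sym ȳ⊗x≡x) ⟩
      (neg y ⊗ x) ⊗ (x ⇒ y)     ≡⟨ ⊗-assoc (neg y) x (x ⇒ y) ⟩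
      neg y ⊗ (x ⊗ (x ⇒ y))     ≡⟨ cong (neg y ⊗_) (sym y-divides) ⟩
      neg y ⊗ y                 ≡⟨ ⊗-comm (neg y) y ⟩
      y ⊗ neg y                 ≡⟨ ⊗-neg y ⟩
      𝟘                         ∎

  -- the defining condition a_i ⊕ a_{i+1} = a_i of good sequences, read in a chain
  good-step : ∀ x y → x ⊕ y ≡ x → x ≡ 𝟙 ⊎ y ≡ 𝟘
  good-step x y x⊕y≡x with ∧-selective (neg x ⇒ y) (neg y ⇒ x)
  ... | inj₁ e = absorbed-left x y (trans (sym e) x⊕y≡x)
  ... | inj₂ e = absorbed-right x y (trans (sym e) x⊕y≡x)

  -- in a chain, z ⊗ w = 0 unless w > z̄ and z > w̄, in which case z ⊕ w = 1
  ⊗-𝟘-or-⊕-𝟙 : ∀ z w → z ⊗ w ≡ 𝟘 ⊎ z ⊕ w ≡ 𝟙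
  ⊗-𝟘-or-⊕-𝟙 z w with total w (neg z) | total z (neg w)
  ... | inj₁ w≤z̄ | _ = inj₁ (trans (⊗-comm z w) (bottom-unique (residual-elim w z 𝟘 w≤z̄)))
  ... | inj₂ _ | inj₁ z≤w̄ = inj₁ (bottom-unique (residual-elim z w 𝟘 z≤w̄))
  ... | inj₂ z̄≤w | inj₂ w̄≤z = inj₂ (trans (cong₂ _∧_ (⇒-of-≤ z̄≤w) (⇒-of-≤ w̄≤z)) (𝟙-top 𝟙))

  module GoodSequence (a : Seq) (a-good : IsGood a) where
    private
      good : ∀ n → a n ⊕ a (suc n) ≡ a n
      good = proj₁ a-good
      r : ℕ
      r = proj₁ (proj₂ a-good)
      eventually-𝟘 : ∀ n → r ≤ℕ n → a n ≡ 𝟘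
      eventually-𝟘 = proj₂ (proj₂ a-good)

    -- once a term is 0, all later terms are 0, since 0 ⊕ y = y
    next-zero : ∀ {k} → a k ≡ 𝟘 → a (suc k) ≡ 𝟘
    next-zero {k} ak≡𝟘 =
      trans (sym (⊕-identityˡ _)) (trans (cong (_⊕ a (suc k)) (sym ak≡𝟘)) (trans (good k) ak≡𝟘))

    zeros-from : ∀ {k} → a k ≡ 𝟘 → ∀ j → k ≤ℕ j → a j ≡ 𝟘
    zeros-from ak≡𝟘 zero z≤n = ak≡𝟘
    zeros-from ak≡𝟘 (suc j) k≤j with ℕ.m≤n⇒m<n∨m≡n k≤j
    ... | inj₁ (s≤s k≤j′) = next-zero (zeros-from ak≡𝟘 j k≤j′)
    ... | inj₂ refl = ak≡𝟘

    ones-or-staircase : ∀ n → (∀ j → j <ℕ n → a j ≡ 𝟙) ⊎ Staircase a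
    ones-or-staircase zero = inj₁ (λ _ ())
    ones-or-staircase (suc n) with ones-or-staircase n
    ... | inj₂ S = inj₂ S
    ... | inj₁ ones with good-step (a n) (a (suc n)) (good n)
    ...   | inj₂ next≡𝟘 = inj₂ (record { step = n ; ones = ones ; zeros = zeros-from next≡𝟘 })
    ...   | inj₁ an≡𝟙 = inj₁ ones′
      where
      ones′ : ∀ j → j <ℕ suc n → a j ≡ 𝟙
      ones′ j j<n+1 with ℕ.m<1+n⇒m<n∨m≡n j<n+1
      ... | inj₁ j<n = ones j j<n
      ... | inj₂ refl = an≡𝟙

    -- past position r every term is 0, so the scan up to r ends in a staircase
    staircase : Staircase a
    staircase with ones-or-staircase r
    ... | inj₂ S = S
    ... | inj₁ ones =
      record { step = r ; ones = ones ; zeros = λ j r<j → eventually-𝟘 j (ℕ.<⇒≤ r<j) }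

  good⇒staircase : ∀ a → IsGood a → Staircase a
  good⇒staircase = GoodSequence.staircase

  -- in a chain the sum of staircases is a staircase; its step is m+p or m+p+1
  -- according to whether s_m ⊗ t_p = 0 or s_m ⊕ t_p = 1
  module _ {s t : Seq} (S : Staircase s) (T : Staircase t) where
    open Staircase S using () renaming (step to m)
    open Staircase T using () renaming (step to p)
    open StaircaseSum S T

    +ₛ-staircase : Staircase (s +ₛ t)
    +ₛ-staircase with ⊗-𝟘-or-⊕-𝟙 (s m) (t p)
    ... | inj₁ ⊗≡𝟘 = record { step = m + p ; ones = sum-below ; zeros = zeros }
      where
      zeros : ∀ j → m + p <ℕ j → (s +ₛ t) j ≡ 𝟘
      zeros j m+p<j with ℕ.m≤n⇒m<n∨m≡n m+p<j
      ... | inj₁ m+p+1<j = sum-above j m+p+1<j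
      ... | inj₂ refl = trans sum-next ⊗≡𝟘
    ... | inj₂ ⊕≡𝟙 = record { step = suc (m + p) ; ones = ones ; zeros = sum-above }
      where
      ones : ∀ j → j <ℕ suc (m + p) → (s +ₛ t) j ≡ 𝟙
      ones j j<m+p+1 with ℕ.m<1+n⇒m<n∨m≡n j<m+p+1
      ... | inj₁ j<m+p = sum-below j j<m+p
      ... | inj₂ refl = trans sum-at ⊕≡𝟙

  staircase-< : ∀ {u v} (U : Staircase u) (V : Staircase v)
              → Staircase.step U <ℕ Staircase.step V → u ≤ₛ v
  staircase-< {u} {v} U V m<m′ j with ℕ.<-cmp j (Staircase.step V)
  ... | tri< j<m′ _ _ = subst (u j ≤_) (sym (Staircase.ones V j j<m′)) (𝟙-top (u j))
  ... | tri≈ _ refl _ = subst (_≤ v j) (sym (Staircase.zeros U j m<m′)) (𝟘-bottom (v j))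
  ... | tri> _ _ m′<j = subst (_≤ v j) (sym (Staircase.zeros U j (ℕ.<-trans m<m′ m′<j))) (𝟘-bottom (v j))

  staircase-≡ : ∀ {u v} (U : Staircase u) (V : Staircase v) → Staircase.step U ≡ Staircase.step V
              → u (Staircase.step U) ≤ v (Staircase.step U) → u ≤ₛ v
  staircase-≡ {u} {v} U V refl um≤vm j with ℕ.<-cmp j (Staircase.step U)
  ... | tri< j<m _ _ = subst₂ _≤_ (sym (Staircase.ones U j j<m)) (sym (Staircase.ones V j j<m)) (≤-refl 𝟙)
  ... | tri≈ _ refl _ = um≤vm
  ... | tri> _ _ m<j = subst₂ _≤_ (sym (Staircase.zeros U j m<j)) (sym (Staircase.zeros V j m<j)) (≤-refl 𝟘)

  staircase-comparable : ∀ {u v} → Staircase u → Staircase v → u ≤ₛ v ⊎ v ≤ₛ u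
  staircase-comparable {u} {v} U V with ℕ.<-cmp (Staircase.step U) (Staircase.step V)
  ... | tri< m<m′ _ _ = inj₁ (staircase-< U V m<m′)
  ... | tri> _ _ m′<m = inj₂ (staircase-< V U m′<m)
  ... | tri≈ _ m≡m′ _ with total (u (Staircase.step U)) (v (Staircase.step U))
  ...   | inj₁ um≤vm = inj₁ (staircase-≡ U V m≡m′ um≤vm)
  ...   | inj₂ vm≤um = inj₂ (staircase-≡ V U (sym m≡m′) (subst (λ q → v q ≤ u q) m≡m′ vm≤um))

  -- Part 1: [a,b] and [c,d] are compared through (a+d)+a and (b+c)+a, i.e. with k = a
  chang-total : ChangTotallyOrdered L
  chang-total ((a , a-good) , (b , b-good)) ((c , c-good) , (d , d-good)) =
    orient (staircase-comparable (+ₛ-staircase (+ₛ-staircase A D) A)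
                                 (+ₛ-staircase (+ₛ-staircase B C) A))
    where
    A : Staircase a
    A = good⇒staircase a a-good
    B : Staircase b
    B = good⇒staircase b b-good
    C : Staircase c
    C = good⇒staircase c c-good
    D : Staircase d
    D = good⇒staircase d d-good
    orient : ((a +ₛ d) +ₛ a) ≤ₛ ((b +ₛ c) +ₛ a) ⊎ ((b +ₛ c) +ₛ a) ≤ₛ ((a +ₛ d) +ₛ a)
           → ((a , a-good) , (b , b-good)) ⪯ ((c , c-good) , (d , d-good))
           ⊎ ((c , c-good) , (d , d-good)) ⪯ ((a , a-good) , (b , b-good))
    orient (inj₁ ad≤bc) = inj₁ ((a , a-good) , ad≤bc)
    orient (inj₂ bc≤ad) = inj₂ ((a , a-good) ,
      ≤ₛ-resp (+ₛ-congˡ a (+ₛ-comm B C)) (+ₛ-congˡ a (+ₛ-comm A D)) bc≤ad)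

module Singleton (L : BLAlgebra) where
  open BLAlgebra L
  open BLOps L
  open BLProperties L
  open Sequences L

  single : Carrier → Seq
  single x zero = x
  single x (suc n) = 𝟘

  single-good : ∀ x → IsGood (single x)
  single-good x = good , 1 , eventually-𝟘
    where
    good : ∀ n → single x n ⊕ single x (suc n) ≡ single x n
    good zero = ⊕-identityʳ x
    good (suc n) = ⊕-identityʳ 𝟘
    eventually-𝟘 : ∀ n → 1 ≤ℕ n → single x n ≡ 𝟘
    eventually-𝟘 (suc n) _ = refl

  single-staircase : ∀ x → Staircase (single x)
  single-staircase x = record { step = 0 ; ones = λ _ () ; zeros = λ { (suc j) _ → refl } }

  -- 0̂ is a right unit for singletons: x̂ + 0̂ = (x ⊕ 0, x ⊗ 0, 0, …)
  single-+ₛ-𝟘 : ∀ x n → (single x +ₛ single 𝟘) n ≡ single x n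
  single-+ₛ-𝟘 x zero = trans sum-at (⊕-identityʳ x)
    where open StaircaseSum (single-staircase x) (single-staircase 𝟘)
  single-+ₛ-𝟘 x (suc zero) = trans sum-next (⊗-zeroʳ x)
    where open StaircaseSum (single-staircase x) (single-staircase 𝟘)
  single-+ₛ-𝟘 x (suc (suc n)) = sum-above (suc (suc n)) (s≤s (s≤s z≤n))
    where open StaircaseSum (single-staircase x) (single-staircase 𝟘)

  𝟘-+ₛ-single : ∀ x n → (single 𝟘 +ₛ single x) n ≡ single x n
  𝟘-+ₛ-single x n = trans (+ₛ-comm (single-staircase 𝟘) (single-staircase x) n) (single-+ₛ-𝟘 x n)

module CancellativeChainProperties (L : BLAlgebra) (cancellative : CancellativeChain L) where
  open BLAlgebra L
  open BLOps L
  open BLProperties L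
  open Sequences L
  open Singleton L
  open Chain L (proj₁ cancellative)

  single-+ₛ-reflects-≤ : ∀ x y k → IsGood k → (single x +ₛ k) ≤ₛ (single y +ₛ k) → x ≤ y
  single-+ₛ-reflects-≤ x y k k-good sum≤ with proj₁ cancellative x y
  ... | inj₁ x≤y = x≤y
  ... | inj₂ y≤x = subst (x ≤_) x≡y (≤-refl x)
    where
    K : Staircase k
    K = good⇒staircase k k-good
    p : ℕ
    p = Staircase.step K
    w : Carrier
    w = k p
    module X = StaircaseSum (single-staircase x) K
    module Y = StaircaseSum (single-staircase y) K
    ⊕≤ : (x ⊕ w) ≤ (y ⊕ w)
    ⊕≤ = subst₂ _≤_ X.sum-at Y.sum-at (sum≤ p)
    ⊗≤ : (x ⊗ w) ≤ (y ⊗ w)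
    ⊗≤ = subst₂ _≤_ X.sum-next Y.sum-next (sum≤ (suc p))
    -- with y ≤ x both inequalities are equalities, and cancellation applies
    ⊕≡ : w ⊕ x ≡ w ⊕ y
    ⊕≡ = trans (⊕-comm w x) (trans (≤-antisym ⊕≤ (⊕-monoˡ w y≤x)) (⊕-comm y w))
    ⊗≡ : w ⊗ x ≡ w ⊗ y
    ⊗≡ = trans (⊗-comm w x) (trans (≤-antisym ⊗≤ (⊗-monoˡ w y≤x)) (⊗-comm y w))
    x≡y : x ≡ y
    x≡y = proj₂ cancellative w x y ⊕≡ ⊗≡

module HomomorphismProperties {L M : BLAlgebra} (h : BLHom L M) where
  private
    module L = BLAlgebra L
    module M = BLAlgebra M
    module LO = BLOps L
    module MO = BLOps M
    module LS = Singleton L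
    module MS = Singleton M
  open BLHom h

  image : LO.Seq → MO.Seq
  image s n = f (s n)

  hom-neg : ∀ a → f (LO.neg a) ≡ MO.neg (f a)
  hom-neg a = trans (pres-⇒ a L.𝟘) (cong (f a M.⇒_) pres-𝟘)

  hom-⊕ : ∀ a b → f (a LO.⊕ b) ≡ f a MO.⊕ f b
  hom-⊕ a b = trans (pres-∧ _ _) (cong₂ M._∧_
    (trans (pres-⇒ _ _) (cong (M._⇒ f b) (hom-neg a)))
    (trans (pres-⇒ _ _) (cong (M._⇒ f a) (hom-neg b))))

  hom-ext : ∀ s q → f (LO.ext s q) ≡ MO.ext (image s) q
  hom-ext s zero = pres-𝟙
  hom-ext s (suc q) = refl

  hom-psum : ∀ s t i k → f (LO.psum s t i k) ≡ MO.psum (image s) (image t) i k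
  hom-psum s t i zero = trans (pres-⊗ _ _) (cong₂ M._⊗_ (hom-ext s i) pres-𝟙)
  hom-psum s t i (suc k) = trans (hom-⊕ _ _) (cong₂ MO._⊕_ (hom-psum s t i k)
    (trans (pres-⊗ _ _) (cong₂ M._⊗_ (hom-ext s (i ∸ suc k)) (hom-ext t (suc k)))))

  hom-+ₛ : ∀ s t n → image (s LO.+ₛ t) n ≡ (image s MO.+ₛ image t) n
  hom-+ₛ s t n = hom-psum s t (suc n) (suc n)

  hom-good : ∀ s → LO.IsGood s → MO.IsGood (image s)
  hom-good s (good , r , eventually-𝟘) =
    (λ n → trans (sym (hom-⊕ _ _)) (cong f (good n))) ,
    r , (λ n r≤n → trans (cong f (eventually-𝟘 n r≤n)) pres-𝟘)

  hom-≤ : ∀ {a b} → a LO.≤ b → f a MO.≤ f b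
  hom-≤ a≤b = trans (sym (pres-∧ _ _)) (cong f a≤b)

  hom-single : ∀ x n → image (LS.single x) n ≡ MS.single (f x) n
  hom-single x zero = refl
  hom-single x (suc n) = pres-𝟘

  hom-single-+ₛ : ∀ x k n → image (LS.single x LO.+ₛ k) n ≡ (MS.single (f x) MO.+ₛ image k) n
  hom-single-+ₛ x k n = trans (hom-+ₛ (LS.single x) k n) (Sequences.+ₛ-congˡ M (image k) (hom-single x) n)

module CancellativeType⇒Chain (L : BLAlgebra) (cancellative-type : CancellativeType L) where
  open BLAlgebra L
  open BLOps L
  open Sequences L
  open Singleton L

  I : Set
  I = proj₁ cancellative-type
  C : I → BLAlgebra
  C = proj₁ (proj₂ cancellative-type)
  factors-cancellative : ∀ i → CancellativeChain (C i)
  factors-cancellative = proj₁ (proj₂ (proj₂ cancellative-type))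
  open SubdirectProduct (proj₂ (proj₂ (proj₂ cancellative-type)))

  -- x̂ + k ≤ ŷ + k in L gives the same in every factor, hence x ≤ y coordinatewise
  single-+ₛ-reflects-≤ : ∀ x y k → IsGood k → (single x +ₛ k) ≤ₛ (single y +ₛ k) → x ≤ y
  single-+ₛ-reflects-≤ x y k k-good sum≤ =
    jointly-injective (x ∧ y) x (λ i → trans (BLHom.pres-∧ (π i) x y) (in-factor i))
    where
    in-factor : ∀ i → BLAlgebra._∧_ (C i) (BLHom.f (π i) x) (BLHom.f (π i) y) ≡ BLHom.f (π i) x
    in-factor i = CancellativeChainProperties.single-+ₛ-reflects-≤ (C i) (factors-cancellative i)
      (f x) (f y) (image k) (hom-good k k-good)
      (Sequences.≤ₛ-resp (C i) (hom-single-+ₛ x k) (hom-single-+ₛ y k) (λ n → hom-≤ (sum≤ n)))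
      where open HomomorphismProperties (π i)
            open BLHom (π i) using (f)

  embed : Carrier → ChangElem
  embed x = (single x , single-good x) , (single 𝟘 , single-good 𝟘)

  -- embed x ⪯ embed y means (x̂+0̂)+k ≤ (0̂+ŷ)+k, i.e. x̂+k ≤ ŷ+k
  single-⪯-reflects-≤ : ∀ x y → embed x ⪯ embed y → x ≤ y
  single-⪯-reflects-≤ x y ((k , k-good) , sums≤) = single-+ₛ-reflects-≤ x y k k-good
    (≤ₛ-resp (+ₛ-congˡ k (single-+ₛ-𝟘 x)) (+ₛ-congˡ k (𝟘-+ₛ-single y)) sums≤)

  chain : ChangTotallyOrdered L → TotallyOrdered L
  chain chang-total x y with chang-total (embed x) (embed y)
  ... | inj₁ x⪯y = inj₁ (single-⪯-reflects-≤ x y x⪯y)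
  ... | inj₂ y⪯x = inj₂ (single-⪯-reflects-≤ y x y⪯x)

lemma6p3 : ((L : BLAlgebra) → TotallyOrdered L → ChangTotallyOrdered L)
         × ((L : BLAlgebra) → CancellativeType L → ChangTotallyOrdered L → TotallyOrdered L)
lemma6p3 = Chain.chang-total , CancellativeType⇒Chain.chain
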